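{- Let $\Delta$ be a $(d-1)$-dimensional boolean complex with nonnegative, symmetric $h$-vector $h=(h_0,\dots,h_d)$ and $\gamma$-vector $\gamma=(\gamma_0,\dots,\gamma_{\lfloor d/2\rfloor})$. If $\gamma$ is the $f$-vector of a simplicial complex, then $h$ is the $f$-vector of a simplicial complex.
   Context: A boolean complex is a regular cell complex whose lower intervals $[\emptyset,F]$ in the face poset are boolean lattices. $f(\Delta;t)=\sum_Ft^{1+\dim F}$ (empty face included), $\sum_ih_it^i=(1-t)^df(\Delta;t/(1-t))$; symmetric means $h_i=h_{d-i}$, and then $\gamma$ is defined by $\sum_ih_it^i=\sum_{i=0}^{\lfloor d/2\rfloor}\gamma_it^i(1+t)^{d-2i}$. The $f$-vector of a simplicial complex is $(f_0,f_1,\dots)$ with $f_i$ the number of faces with $i$ vertices ($f_0=1$), with trailing zeros allowed. -}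

module Defs where

open import Data.Nat as ℕ using (ℕ; zero; suc; _∸_; _≟_; _≡ᵇ_; _≤ᵇ_; ⌊_/2⌋)
open import Data.Nat.Combinatorics using (_C_)
open import Data.Integer as ℤ using (ℤ; +_; -_)
open import Data.Fin using (Fin)
open import Data.Fin.Subset using (Subset; _⊆_; ⊥; ∣_∣)
open import Data.Vec using (_∷_; [])
open import Data.Bool using (Bool; true; false; T; _∧_; if_then_else_)
open import Data.List using (List; []; _∷_; _++_; map; length; filter; filterᵇ; upTo; foldr)
open import Data.List using (allFin)
open import Data.Product using (Σ; ∃; _×_; _,_; proj₁)
open import Relation.Binary.Structures using (IsPartialOrder)
open import Relation.Binary.PropositionalEquality using (_≡_)
open import Function.Bundles using (_⇔_)

Σℤ[≤_] : ℕ → (ℕ → ℤ) → ℤ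
Σℤ[≤ n ] f = foldr (λ i acc → f i ℤ.+ acc) (+ 0) (upTo (suc n))

-- Boolean complexes, given by their face posets (simplicial posets):
-- a finite poset with a least element (the empty face) such that every
-- lower interval [∅ , x] is isomorphic, as a poset, to the boolean
-- lattice of subsets of a finite set of size  rank x  (= 1 + dim x).

record BooleanComplex : Set₁ where
  field
    nfaces  : ℕ
    _≼_     : Fin nfaces → Fin nfaces → Set
    isPO    : IsPartialOrder _≡_ _≼_
    empty   : Fin nfaces
    empty-≼ : ∀ x → empty ≼ x
    rank    : Fin nfaces → ℕ
    toSub   : (x : Fin nfaces) → Σ (Fin nfaces) (λ y → y ≼ x) → Subset (rank x)
    fromSub : (x : Fin nfaces) → Subset (rank x) → Σ (Fin nfaces) (λ y → y ≼ x)
    from-to : ∀ x y (p : y ≼ x) → proj₁ (fromSub x (toSub x (y , p))) ≡ y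
    to-from : ∀ x (S : Subset (rank x)) → toSub x (fromSub x S) ≡ S
    toSub-mono : ∀ x y z (p : y ≼ x) (q : z ≼ x) →
                 (y ≼ z) ⇔ (toSub x (y , p) ⊆ toSub x (z , q))

open BooleanComplex public

-- f_i(Δ) = number of faces with i vertices (dimension i - 1); f_0 = 1.
fBC : BooleanComplex → ℕ → ℕ
fBC Δ i = length (filterᵇ (λ x → rank Δ x ≡ᵇ i) (allFin (nfaces Δ)))

HasDim-1 : BooleanComplex → ℕ → Set
HasDim-1 Δ d = (∀ x → rank Δ x ℕ.≤ d) × ∃ (λ x → rank Δ x ≡ d)

sgn : ℕ → ℤ
sgn zero = + 1
sgn (suc n) = - sgn n

-- h-vector of a (d-1)-dimensional complex with f-vector f:
-- Σ_k h_k t^k = Σ_i f_i t^i (1-t)^(d-i), i.e.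
-- h_k = Σ_{i=0}^{k} (-1)^(k-i) C(d-i, k-i) f_i .
hvec : ℕ → (ℕ → ℕ) → ℕ → ℤ
hvec d f k = Σℤ[≤ k ] (λ i → sgn (k ∸ i) ℤ.* (+ ((d ∸ i) C (k ∸ i))) ℤ.* (+ f i))

hBC : BooleanComplex → ℕ → ℕ → ℤ
hBC Δ d = hvec d (fBC Δ)

-- coefficient of t^k in t^i (1+t)^(d-2i)
γcoef : ℕ → ℕ → ℕ → ℤ
γcoef d i k = if i ≤ᵇ k then + ((d ∸ (i ℕ.+ i)) C (k ∸ i)) else + 0

IsGammaVector : ℕ → (ℕ → ℤ) → (ℕ → ℤ) → Set
IsGammaVector d h γ = ∀ k → k ℕ.≤ d → h k ≡ Σℤ[≤ ⌊ d /2⌋ ] (λ i → γ i ℤ.* γcoef d i k)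

allSubsets : (m : ℕ) → List (Subset m)
allSubsets zero = [] ∷ []
allSubsets (suc m) = map (false ∷_) (allSubsets m) ++ map (true ∷_) (allSubsets m)

record SimplicialComplex : Set where
  field
    nverts    : ℕ
    isFace    : Subset nverts → Bool
    empty-face : T (isFace ⊥)
    down-closed : ∀ S R → S ⊆ R → T (isFace R) → T (isFace S)

open SimplicialComplex public

fSC : SimplicialComplex → ℕ → ℕ
fSC K i = length (filterᵇ (λ S → isFace K S ∧ (∣ S ∣ ≡ᵇ i)) (allSubsets (nverts K)))

IsFVector : ℕ → (ℕ → ℤ) → Set
IsFVector L v = ∃ λ (K : SimplicialComplex) →
  ∀ i → (i ℕ.≤ L → + fSC K i ≡ v i) × (L ℕ.< i → fSC K i ≡ 0)

module Submission where

-- Let Γ be a simplicial complex with f-vector γ and adjoin d new vertices u₁, …, u_d.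
-- The sets F ∪ S with F ∈ Γ and S ⊆ {u₁, …, u_(d − 2|F|)} form a simplicial complex,
-- because shrinking F only enlarges the room left for S. A face F with i vertices lies
-- in C(d − 2i, k − i) of these sets of size k, so the complex has Σᵢ γᵢ C(d − 2i, k − i)
-- faces with k vertices: the coefficient of tᵏ in Σᵢ γᵢ tⁱ (1 + t)^(d − 2i), which is hₖ.

open import Defs
open import Data.Nat using (ℕ; _≤_; _∸_; ⌊_/2⌋)
open import Data.Integer using (ℤ; +_) renaming (_≤_ to _≤ℤ_)
open import Relation.Binary.PropositionalEquality using (_≡_)

open import Data.Nat using (zero; suc; _+_; _*_; _<_; z≤n; s≤s; _≡ᵇ_; _≤ᵇ_)
open import Data.Nat.Properties
  using (+-identityʳ; +-assoc; *-identityˡ; *-zeroʳ; *-distribʳ-+; +-comm; +-mono-≤; ≤-trans; ≤-<-trans;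
         m≤m+n; m≤n+m; m∸n≤m; ∸-monoʳ-≤; ∸-monoˡ-<; ⌊n/2⌋≤n; +-commutativeSemigroup)
open import Algebra.Properties.CommutativeSemigroup +-commutativeSemigroup using (interchange)
open import Data.Nat.Combinatorics using (_C_; k>n⇒nCk≡0; nCk+nC[k+1]≡[n+1]C[k+1])
import Data.Integer as ℤ
open import Data.Integer.Properties using (pos-*) renaming (+-identityʳ to ℤ-+-identityʳ)
open import Data.Bool using (Bool; true; false; T; not; _∧_; if_then_else_)
open import Data.Bool.Properties using (T-∧; ∧-assoc; ∧-zeroʳ; if-float)
open import Data.Unit using (tt)
open import Data.List using (List; []; _∷_; map; length; filterᵇ; foldr; applyUpTo)
  renaming (_++_ to _++ₗ_)
open import Data.Vec using ([]; _∷_; _++_; take; drop; here)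
open import Data.Fin.Subset using (Subset; _⊆_; ∣_∣) renaming (⊥ to ∅)
open import Data.Fin.Subset.Properties using (drop-∷-⊆; out⊆; s⊆s; ∣p∣≤n; p⊆q⇒∣p∣≤∣q∣)
open import Data.Product using (_,_; proj₁; proj₂)
open import Function using (_∘_; id)
open import Function.Bundles using (Equivalence)
open import Relation.Binary.PropositionalEquality using (refl; sym; trans; cong; cong₂)
open Relation.Binary.PropositionalEquality.≡-Reasoning

private variable
  A : Set

𝟙 : Bool → ℕ
𝟙 true  = 1
𝟙 false = 0

∑ : List A → (A → ℕ) → ℕ
∑ []       f = 0
∑ (x ∷ xs) f = f x + ∑ xs f

syntax ∑ xs (λ x → e) = ∑[ x ∈ xs ] e

∑-cong : {f g : A → ℕ} → (∀ x → f x ≡ g x) → ∀ xs → ∑ xs f ≡ ∑ xs g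
∑-cong f≗g []       = refl
∑-cong f≗g (x ∷ xs) = cong₂ _+_ (f≗g x) (∑-cong f≗g xs)

∑-zero : (xs : List A) → ∑[ x ∈ xs ] 0 ≡ 0
∑-zero []       = refl
∑-zero (x ∷ xs) = ∑-zero xs

∑-++ : (xs ys : List A) (f : A → ℕ) → ∑ (xs ++ₗ ys) f ≡ ∑ xs f + ∑ ys f
∑-++ []       ys f = refl
∑-++ (x ∷ xs) ys f = trans (cong (_+_ (f x)) (∑-++ xs ys f)) (sym (+-assoc (f x) _ _))

∑-map : {B : Set} (g : A → B) (xs : List A) (f : B → ℕ) → ∑ (map g xs) f ≡ ∑[ x ∈ xs ] f (g x)
∑-map g []       f = refl
∑-map g (x ∷ xs) f = cong (_+_ (f (g x))) (∑-map g xs f)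

∑-*ʳ : (xs : List A) (f : A → ℕ) (c : ℕ) → ∑[ x ∈ xs ] (f x * c) ≡ ∑ xs f * c
∑-*ʳ []       f c = refl
∑-*ʳ (x ∷ xs) f c = trans (cong (_+_ (f x * c)) (∑-*ʳ xs f c)) (sym (*-distribʳ-+ c (f x) _))

∑-𝟙-∧ : (b : Bool) (q : A → Bool) (xs : List A) → ∑[ x ∈ xs ] 𝟙 (b ∧ q x) ≡ 𝟙 b * ∑[ x ∈ xs ] 𝟙 (q x)
∑-𝟙-∧ true  q xs = sym (*-identityˡ _)
∑-𝟙-∧ false q xs = ∑-zero xs

length-filterᵇ : (p : A → Bool) (xs : List A) → length (filterᵇ p xs) ≡ ∑[ x ∈ xs ] 𝟙 (p x)
length-filterᵇ p []       = refl
length-filterᵇ p (x ∷ xs) with p x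
... | true  = cong suc (length-filterᵇ p xs)
... | false = length-filterᵇ p xs

∑≤ : ℕ → (ℕ → ℕ) → ℕ
∑≤ zero    f = f 0
∑≤ (suc N) f = f 0 + ∑≤ N (f ∘ suc)

syntax ∑≤ N (λ i → e) = ∑[ i ≤ N ] e

∑≤-cong : ∀ N {f g : ℕ → ℕ} → (∀ i → i ≤ N → f i ≡ g i) → ∑≤ N f ≡ ∑≤ N g
∑≤-cong zero    f≗g = f≗g 0 z≤n
∑≤-cong (suc N) f≗g = cong₂ _+_ (f≗g 0 z≤n) (∑≤-cong N (λ i i≤N → f≗g (suc i) (s≤s i≤N)))

∑≤-zero : ∀ N → ∑[ i ≤ N ] 0 ≡ 0
∑≤-zero zero    = refl
∑≤-zero (suc N) = ∑≤-zero N

∑≤-+ : ∀ N (f g : ℕ → ℕ) → ∑[ i ≤ N ] (f i + g i) ≡ ∑≤ N f + ∑≤ N g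
∑≤-+ zero    f g = refl
∑≤-+ (suc N) f g = trans (cong (_+_ (f 0 + g 0)) (∑≤-+ N (f ∘ suc) (g ∘ suc)))
                         (interchange (f 0) (g 0) _ _)

∑≤-truncate : ∀ L e (f : ℕ → ℕ) → (∀ i → L < i → f i ≡ 0) → ∑≤ (L + e) f ≡ ∑≤ L f
∑≤-truncate zero    zero    f f>0≡0 = refl
∑≤-truncate zero    (suc e) f f>0≡0 =
  trans (cong (_+_ (f 0)) (trans (∑≤-cong e (λ i _ → f>0≡0 (suc i) (s≤s z≤n))) (∑≤-zero e)))
        (+-identityʳ (f 0))
∑≤-truncate (suc L) e f f>L≡0 = cong (_+_ (f 0)) (∑≤-truncate L e (f ∘ suc) (λ i L<i → f>L≡0 (suc i) (s≤s L<i)))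

∑≤-indicator : ∀ N (b : Bool) c (H : ℕ → ℕ) → c ≤ N → ∑[ i ≤ N ] (𝟙 (b ∧ (c ≡ᵇ i)) * H i) ≡ 𝟙 b * H c
∑≤-indicator N       false c       H _         = ∑≤-zero N
∑≤-indicator zero    true  zero    H _         = refl
∑≤-indicator (suc N) true  zero    H _         = trans (cong (_+_ (1 * H 0)) (∑≤-zero N)) (+-identityʳ _)
∑≤-indicator (suc N) true  (suc c) H (s≤s c≤N) = ∑≤-indicator N true c (H ∘ suc) c≤N

∑-∑≤-comm : ∀ N (xs : List A) (g : A → ℕ → ℕ) →
            ∑[ x ∈ xs ] ∑[ i ≤ N ] g x i ≡ ∑[ i ≤ N ] ∑[ x ∈ xs ] g x i
∑-∑≤-comm N []       g = sym (∑≤-zero N)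
∑-∑≤-comm N (x ∷ xs) g = trans (cong (_+_ (∑≤ N (g x))) (∑-∑≤-comm N xs g))
                               (sym (∑≤-+ N (g x) (λ i → ∑[ y ∈ xs ] g y i)))

∑-groupBy : ∀ N (s : A → ℕ) → (∀ x → s x ≤ N) → (p : A → Bool) (H : ℕ → ℕ) (xs : List A) →
            ∑[ x ∈ xs ] (𝟙 (p x) * H (s x))
            ≡ ∑[ i ≤ N ] (length (filterᵇ (λ x → p x ∧ (s x ≡ᵇ i)) xs) * H i)
∑-groupBy N s s≤N p H xs = begin
  ∑[ x ∈ xs ] (𝟙 (p x) * H (s x))
    ≡⟨ ∑-cong (λ x → sym (∑≤-indicator N (p x) (s x) H (s≤N x))) xs ⟩
  ∑[ x ∈ xs ] ∑[ i ≤ N ] (𝟙 (p x ∧ (s x ≡ᵇ i)) * H i)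
    ≡⟨ ∑-∑≤-comm N xs (λ x i → 𝟙 (p x ∧ (s x ≡ᵇ i)) * H i) ⟩
  ∑[ i ≤ N ] ∑[ x ∈ xs ] (𝟙 (p x ∧ (s x ≡ᵇ i)) * H i)
    ≡⟨ ∑≤-cong N (λ i _ → trans (∑-*ʳ xs (λ x → 𝟙 (p x ∧ (s x ≡ᵇ i))) (H i))
                                (cong (_* H i) (sym (length-filterᵇ _ xs)))) ⟩
  ∑[ i ≤ N ] (length (filterᵇ (λ x → p x ∧ (s x ≡ᵇ i)) xs) * H i) ∎

Σℤ-applyUpTo : ∀ N (h : ℕ → ℕ) {f : ℕ → ℤ} {g : ℕ → ℕ} → (∀ j → j ≤ N → f (h j) ≡ + g (h j)) →
               foldr (λ i acc → f i ℤ.+ acc) (+ 0) (applyUpTo h (suc N)) ≡ + ∑[ j ≤ N ] g (h j)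
Σℤ-applyUpTo zero    h f≗g = trans (cong (ℤ._+ + 0) (f≗g 0 z≤n)) (ℤ-+-identityʳ _)
Σℤ-applyUpTo (suc N) h {f} {g} f≗g =
  cong₂ ℤ._+_ (f≗g 0 z≤n) (Σℤ-applyUpTo N (h ∘ suc) {f} {g} (λ j j≤N → f≗g (suc j) (s≤s j≤N)))

Σℤ-pos : ∀ N {f : ℕ → ℤ} {g : ℕ → ℕ} → (∀ i → i ≤ N → f i ≡ + g i) → Σℤ[≤ N ] f ≡ + ∑≤ N g
Σℤ-pos N = Σℤ-applyUpTo N id

∑-allSubsets-suc : ∀ d (f : Subset (suc d) → ℕ) →
                   ∑ (allSubsets (suc d)) f
                   ≡ ∑[ S ∈ allSubsets d ] f (false ∷ S) + ∑[ S ∈ allSubsets d ] f (true ∷ S)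
∑-allSubsets-suc d f = begin
  ∑ (map (false ∷_) (allSubsets d) ++ₗ map (true ∷_) (allSubsets d)) f
    ≡⟨ ∑-++ (map (false ∷_) (allSubsets d)) _ f ⟩
  ∑ (map (false ∷_) (allSubsets d)) f + ∑ (map (true ∷_) (allSubsets d)) f
    ≡⟨ cong₂ _+_ (∑-map (false ∷_) (allSubsets d) f) (∑-map (true ∷_) (allSubsets d) f) ⟩
  ∑[ S ∈ allSubsets d ] f (false ∷ S) + ∑[ S ∈ allSubsets d ] f (true ∷ S) ∎

∑-allSubsets-++ : ∀ m d (f : Subset (m + d) → ℕ) →
                  ∑ (allSubsets (m + d)) f ≡ ∑[ F ∈ allSubsets m ] ∑[ S ∈ allSubsets d ] f (F ++ S)
∑-allSubsets-++ zero    d f = sym (+-identityʳ _)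
∑-allSubsets-++ (suc m) d f = begin
  ∑ (allSubsets (suc m + d)) f
    ≡⟨ ∑-allSubsets-suc (m + d) f ⟩
  ∑[ V ∈ allSubsets (m + d) ] f (false ∷ V) + ∑[ V ∈ allSubsets (m + d) ] f (true ∷ V)
    ≡⟨ cong₂ _+_ (∑-allSubsets-++ m d (f ∘ (false ∷_))) (∑-allSubsets-++ m d (f ∘ (true ∷_))) ⟩
  ∑[ F ∈ allSubsets m ] ∑[ S ∈ allSubsets d ] f (false ∷ F ++ S)
    + ∑[ F ∈ allSubsets m ] ∑[ S ∈ allSubsets d ] f (true ∷ F ++ S)
    ≡⟨ sym (∑-allSubsets-suc m (λ F → ∑[ S ∈ allSubsets d ] f (F ++ S))) ⟩
  ∑[ F ∈ allSubsets (suc m) ] ∑[ S ∈ allSubsets d ] f (F ++ S) ∎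

∣++∣ : ∀ {m d} (F : Subset m) (S : Subset d) → ∣ F ++ S ∣ ≡ ∣ F ∣ + ∣ S ∣
∣++∣ []          S = refl
∣++∣ (true ∷ F)  S = cong suc (∣++∣ F S)
∣++∣ (false ∷ F) S = ∣++∣ F S

take-++ : ∀ {m d} (F : Subset m) (S : Subset d) → take m (F ++ S) ≡ F
take-++ []      S = refl
take-++ (b ∷ F) S = cong (b ∷_) (take-++ F S)

drop-++ : ∀ {m d} (F : Subset m) (S : Subset d) → drop m (F ++ S) ≡ S
drop-++ []      S = refl
drop-++ (b ∷ F) S = drop-++ F S

take-∅ : ∀ m {d} → take m (∅ {m + d}) ≡ ∅
take-∅ zero    = refl
take-∅ (suc m) = cong (false ∷_) (take-∅ m)

drop-∅ : ∀ m {d} → drop m (∅ {m + d}) ≡ ∅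
drop-∅ zero    = refl
drop-∅ (suc m) = drop-∅ m

take-⊆ : ∀ m {d} {V W : Subset (m + d)} → V ⊆ W → take m V ⊆ take m W
take-⊆ zero    _ ()
take-⊆ (suc m) {V = false ∷ V} {w ∷ W} V⊆W = out⊆ (take-⊆ m (drop-∷-⊆ V⊆W))
take-⊆ (suc m) {V = true  ∷ V} {w ∷ W} V⊆W with V⊆W here
... | here = s⊆s (take-⊆ m (drop-∷-⊆ V⊆W))

drop-⊆ : ∀ m {d} {V W : Subset (m + d)} → V ⊆ W → drop m V ⊆ drop m W
drop-⊆ zero    V⊆W = V⊆W
drop-⊆ (suc m) {V = v ∷ V} {w ∷ W} V⊆W = drop-⊆ m (drop-∷-⊆ V⊆W)

inPrefix : ∀ {d} → ℕ → Subset d → Bool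
inPrefix _       []      = true
inPrefix zero    (b ∷ S) = not b ∧ inPrefix zero S
inPrefix (suc n) (_ ∷ S) = inPrefix n S

inPrefix-∅ : ∀ {d} n → T (inPrefix n (∅ {d}))
inPrefix-∅ {zero}  n       = tt
inPrefix-∅ {suc d} zero    = inPrefix-∅ {d} zero
inPrefix-∅ {suc d} (suc n) = inPrefix-∅ {d} n

inPrefix-mono : ∀ {d n n′} (S : Subset d) → n ≤ n′ → T (inPrefix n S) → T (inPrefix n′ S)
inPrefix-mono []          _                   _ = tt
inPrefix-mono (b ∷ S)     (z≤n {zero})        t = t
inPrefix-mono (false ∷ S) (z≤n {suc n′})      t = inPrefix-mono S z≤n t
inPrefix-mono (b ∷ S)     (s≤s n≤n′)          t = inPrefix-mono S n≤n′ t

inPrefix-⊆ : ∀ {d} n {S R : Subset d} → S ⊆ R → T (inPrefix n R) → T (inPrefix n S)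
inPrefix-⊆ n       {[]}        {[]}    _   _ = tt
inPrefix-⊆ (suc n) {s ∷ S}     {r ∷ R} S⊆R t = inPrefix-⊆ n (drop-∷-⊆ S⊆R) t
inPrefix-⊆ zero    {false ∷ S} {r ∷ R} S⊆R t = inPrefix-⊆ zero (drop-∷-⊆ S⊆R) (proj₂ (Equivalence.to T-∧ t))
inPrefix-⊆ zero    {true ∷ S}  {r ∷ R} S⊆R t with S⊆R here
inPrefix-⊆ zero    {true ∷ S}  {r ∷ R} S⊆R () | here

count-inPrefix : ∀ d n j → n ≤ d → ∑[ S ∈ allSubsets d ] 𝟙 (inPrefix n S ∧ (∣ S ∣ ≡ᵇ j)) ≡ n C j
count-inPrefix zero    zero    zero    _ = refl
count-inPrefix zero    zero    (suc j) _ = refl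
count-inPrefix (suc d) zero    j       _ = begin
  ∑[ S ∈ allSubsets (suc d) ] 𝟙 (inPrefix 0 S ∧ (∣ S ∣ ≡ᵇ j))
    ≡⟨ ∑-allSubsets-suc d _ ⟩
  ∑[ S ∈ allSubsets d ] 𝟙 (inPrefix 0 S ∧ (∣ S ∣ ≡ᵇ j)) + ∑[ S ∈ allSubsets d ] 0
    ≡⟨ cong₂ _+_ (count-inPrefix d 0 j z≤n) (∑-zero (allSubsets d)) ⟩
  0 C j + 0
    ≡⟨ +-identityʳ _ ⟩
  0 C j ∎
count-inPrefix (suc d) (suc n) j (s≤s n≤d) = begin
  ∑[ S ∈ allSubsets (suc d) ] 𝟙 (inPrefix (suc n) S ∧ (∣ S ∣ ≡ᵇ j))
    ≡⟨ ∑-allSubsets-suc d _ ⟩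
  ∑[ S ∈ allSubsets d ] 𝟙 (inPrefix n S ∧ (∣ S ∣ ≡ᵇ j))
    + ∑[ S ∈ allSubsets d ] 𝟙 (inPrefix n S ∧ (suc ∣ S ∣ ≡ᵇ j))
    ≡⟨ cong₂ _+_ (count-inPrefix d n j n≤d) (count-withFirst j) ⟩
  n C j + withFirst j
    ≡⟨ pascal j ⟩
  suc n C j ∎
  where
  withFirst : ℕ → ℕ
  withFirst zero    = 0
  withFirst (suc j) = n C j

  count-withFirst : ∀ j → ∑[ S ∈ allSubsets d ] 𝟙 (inPrefix n S ∧ (suc ∣ S ∣ ≡ᵇ j)) ≡ withFirst j
  count-withFirst zero    = trans (∑-cong (λ S → cong 𝟙 (∧-zeroʳ (inPrefix n S))) (allSubsets d))
                                  (∑-zero (allSubsets d))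
  count-withFirst (suc j) = count-inPrefix d n j n≤d

  pascal : ∀ j → n C j + withFirst j ≡ suc n C j
  pascal zero    = refl
  pascal (suc j) = trans (+-comm (n C suc j) (n C j)) (nCk+nC[k+1]≡[n+1]C[k+1] n j)

-- The clauses for c = 1 and c = 2 + c′ are separated so that suc c ≤ᵇ suc k reduces to c ≤ᵇ k.
count-inPrefix-shifted : ∀ {d n} → n ≤ d → ∀ c k →
  ∑[ S ∈ allSubsets d ] 𝟙 (inPrefix n S ∧ (c + ∣ S ∣ ≡ᵇ k)) ≡ (if c ≤ᵇ k then n C (k ∸ c) else 0)
count-inPrefix-shifted {d} {n} n≤d zero k = count-inPrefix d n k n≤d
count-inPrefix-shifted {d} {n} n≤d (suc c) zero =
  trans (∑-cong (λ S → cong 𝟙 (∧-zeroʳ (inPrefix n S))) (allSubsets d)) (∑-zero (allSubsets d))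
count-inPrefix-shifted n≤d (suc zero)    (suc k) = count-inPrefix-shifted n≤d zero k
count-inPrefix-shifted n≤d (suc (suc c)) (suc k) = count-inPrefix-shifted n≤d (suc c) k

γcoefℕ : ℕ → ℕ → ℕ → ℕ
γcoefℕ d i k = if i ≤ᵇ k then (d ∸ (i + i)) C (k ∸ i) else 0

γcoef≡+γcoefℕ : ∀ d i k → γcoef d i k ≡ + γcoefℕ d i k
γcoef≡+γcoefℕ d i k = sym (if-float +_ (i ≤ᵇ k))

γcoefℕ-vanishes : ∀ {d i k} → i ≤ d → d < k → γcoefℕ d i k ≡ 0
γcoefℕ-vanishes {d} {i} {k} i≤d d<k with i ≤ᵇ k
... | true  = k>n⇒nCk≡0 (≤-<-trans (∸-monoʳ-≤ d (m≤m+n i i)) (∸-monoˡ-< d<k i≤d))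
... | false = refl

module HComplex (Γ : SimplicialComplex) (d : ℕ) where

  m : ℕ
  m = nverts Γ

  room : Subset m → ℕ
  room F = d ∸ (∣ F ∣ + ∣ F ∣)

  isHFace : Subset (m + d) → Bool
  isHFace V = isFace Γ (take m V) ∧ inPrefix (room (take m V)) (drop m V)

  isHFace-∅ : T (isHFace ∅)
  isHFace-∅ rewrite take-∅ m {d} | drop-∅ m {d} = Equivalence.from T-∧ (empty-face Γ , inPrefix-∅ {d} (room ∅))

  isHFace-⊆ : ∀ V W → V ⊆ W → T (isHFace W) → T (isHFace V)
  isHFace-⊆ V W V⊆W W-face = Equivalence.from T-∧
    ( down-closed Γ _ _ (take-⊆ m V⊆W) take-face
    , inPrefix-mono (drop m V) room-mono (inPrefix-⊆ (room (take m W)) (drop-⊆ m V⊆W) drop-inPrefix) )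
    where
    take-face = proj₁ (Equivalence.to T-∧ W-face)
    drop-inPrefix = proj₂ (Equivalence.to T-∧ W-face)
    ∣take∣≤ = p⊆q⇒∣p∣≤∣q∣ (take-⊆ m V⊆W)
    room-mono = ∸-monoʳ-≤ d (+-mono-≤ ∣take∣≤ ∣take∣≤)

  hComplex : SimplicialComplex
  hComplex = record
    { nverts      = m + d
    ; isFace      = isHFace
    ; empty-face  = isHFace-∅
    ; down-closed = isHFace-⊆
    }

  count-extensions : ∀ k (F : Subset m) →
    ∑[ S ∈ allSubsets d ] 𝟙 (isHFace (F ++ S) ∧ (∣ F ++ S ∣ ≡ᵇ k)) ≡ 𝟙 (isFace Γ F) * γcoefℕ d ∣ F ∣ k
  count-extensions k F = begin
    ∑[ S ∈ allSubsets d ] 𝟙 (isHFace (F ++ S) ∧ (∣ F ++ S ∣ ≡ᵇ k))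
      ≡⟨ ∑-cong (cong 𝟙 ∘ split) (allSubsets d) ⟩
    ∑[ S ∈ allSubsets d ] 𝟙 (isFace Γ F ∧ (inPrefix (room F) S ∧ (∣ F ∣ + ∣ S ∣ ≡ᵇ k)))
      ≡⟨ ∑-𝟙-∧ (isFace Γ F) _ (allSubsets d) ⟩
    𝟙 (isFace Γ F) * ∑[ S ∈ allSubsets d ] 𝟙 (inPrefix (room F) S ∧ (∣ F ∣ + ∣ S ∣ ≡ᵇ k))
      ≡⟨ cong (𝟙 (isFace Γ F) *_) (count-inPrefix-shifted (m∸n≤m d (∣ F ∣ + ∣ F ∣)) ∣ F ∣ k) ⟩
    𝟙 (isFace Γ F) * γcoefℕ d ∣ F ∣ k ∎
    where
    split : ∀ S → (isHFace (F ++ S) ∧ (∣ F ++ S ∣ ≡ᵇ k))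
                  ≡ (isFace Γ F ∧ (inPrefix (room F) S ∧ (∣ F ∣ + ∣ S ∣ ≡ᵇ k)))
    split S rewrite take-++ F S | drop-++ F S | ∣++∣ F S = ∧-assoc (isFace Γ F) _ _

  fSC-hComplex : ∀ L → (∀ i → L < i → fSC Γ i ≡ 0) →
                 ∀ k → fSC hComplex k ≡ ∑[ i ≤ L ] (fSC Γ i * γcoefℕ d i k)
  fSC-hComplex L fΓ>L≡0 k = begin
    fSC hComplex k
      ≡⟨ length-filterᵇ _ (allSubsets (m + d)) ⟩
    ∑[ V ∈ allSubsets (m + d) ] 𝟙 (isHFace V ∧ (∣ V ∣ ≡ᵇ k))
      ≡⟨ ∑-allSubsets-++ m d _ ⟩
    ∑[ F ∈ allSubsets m ] ∑[ S ∈ allSubsets d ] 𝟙 (isHFace (F ++ S) ∧ (∣ F ++ S ∣ ≡ᵇ k))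
      ≡⟨ ∑-cong (count-extensions k) (allSubsets m) ⟩
    ∑[ F ∈ allSubsets m ] (𝟙 (isFace Γ F) * γcoefℕ d ∣ F ∣ k)
      ≡⟨ ∑-groupBy (L + m) ∣_∣ (λ F → ≤-trans (∣p∣≤n F) (m≤n+m m L)) (isFace Γ) _ (allSubsets m) ⟩
    ∑[ i ≤ L + m ] (fSC Γ i * γcoefℕ d i k)
      ≡⟨ ∑≤-truncate L m _ (λ i L<i → cong (_* γcoefℕ d i k) (fΓ>L≡0 i L<i)) ⟩
    ∑[ i ≤ L ] (fSC Γ i * γcoefℕ d i k) ∎

γ-expansion-isFVector : ∀ d (γ : ℕ → ℤ) → IsFVector ⌊ d /2⌋ γ →
                        IsFVector d (λ k → Σℤ[≤ ⌊ d /2⌋ ] (λ i → γ i ℤ.* γcoef d i k))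
γ-expansion-isFVector d γ (Γ , fΓ) = hComplex , λ k → fK≡Σ k , fK≡0 k
  where
  open HComplex Γ d
  L : ℕ
  L = ⌊ d /2⌋

  fK≡ : ∀ k → fSC hComplex k ≡ ∑[ i ≤ L ] (fSC Γ i * γcoefℕ d i k)
  fK≡ = fSC-hComplex L (λ i → proj₂ (fΓ i))

  term≡ : ∀ k i → i ≤ L → γ i ℤ.* γcoef d i k ≡ + (fSC Γ i * γcoefℕ d i k)
  term≡ k i i≤L = trans (cong₂ ℤ._*_ (sym (proj₁ (fΓ i) i≤L)) (γcoef≡+γcoefℕ d i k)) (sym (pos-* (fSC Γ i) (γcoefℕ d i k)))

  fK≡Σ : ∀ k → k ≤ d → + fSC hComplex k ≡ Σℤ[≤ L ] (λ i → γ i ℤ.* γcoef d i k)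
  fK≡Σ k _ = trans (cong +_ (fK≡ k)) (sym (Σℤ-pos L (term≡ k)))

  fK≡0 : ∀ k → d < k → fSC hComplex k ≡ 0
  fK≡0 k d<k = trans (fK≡ k) (trans (∑≤-cong L term≡0) (∑≤-zero L))
    where
    term≡0 : ∀ i → i ≤ L → fSC Γ i * γcoefℕ d i k ≡ 0
    term≡0 i i≤L = trans (cong (fSC Γ i *_) (γcoefℕ-vanishes (≤-trans i≤L (⌊n/2⌋≤n d)) d<k)) (*-zeroʳ (fSC Γ i))

IsFVector-cong : ∀ {L} {v w : ℕ → ℤ} → (∀ k → k ≤ L → v k ≡ w k) → IsFVector L v → IsFVector L w
IsFVector-cong v≡w (K , fK) = K , λ k → (λ k≤L → trans (proj₁ (fK k) k≤L) (v≡w k k≤L)) , proj₂ (fK k)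

proposition6p3 : (d : ℕ) (Δ : BooleanComplex) → HasDim-1 Δ d →
                 (∀ k → k ≤ d → + 0 ≤ℤ hBC Δ d k) →
                 (∀ k → k ≤ d → hBC Δ d k ≡ hBC Δ d (d ∸ k)) →
                 (γ : ℕ → ℤ) → IsGammaVector d (hBC Δ d) γ →
                 IsFVector ⌊ d /2⌋ γ →
                 IsFVector d (hBC Δ d)
proposition6p3 d Δ _ _ _ γ h≡γ-expansion γ-isFVector =
  IsFVector-cong (λ k k≤d → sym (h≡γ-expansion k k≤d)) (γ-expansion-isFVector d γ γ-isFVector)
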